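{- For every program $\alpha$, the canonical relation satisfies $R^c_\alpha=\{(u,v)\in W^c\times W^c:\ \forall\phi\in\mathcal{F}_n\ (v(\phi)=1\Rightarrow u(\langle\alpha\rangle\phi)=1)\}$.
   Context: Language: nonempty $\Pi_0$ of atomic programs, countable $\mathsf{Prop}$; formulas $\phi::=p\mid0\mid\neg\phi\mid\phi\to\phi\mid[\alpha]\phi$, programs $\alpha::=a\mid\phi?\mid\alpha;\alpha\mid\alpha\cup\alpha\mid\alpha^*$; $1:=\neg0$, $\langle\alpha\rangle\phi:=\neg[\alpha]\neg\phi$; abbreviations $\phi\vee\psi:=(\phi\to\psi)\to\psi$, $\phi\wedge\psi:=\neg(\neg\phi\vee\neg\psi)$, $\phi\oplus\psi:=\neg\phi\to\psi$, $\phi\odot\psi:=\neg(\neg\phi\oplus\neg\psi)$, $\phi\leftrightarrow\psi:=(\phi\to\psi)\odot(\psi\to\phi)$, $\psi^k$ the $\odot$-product of $k$ copies. $\mathrm{L}_n=\{i/n:0\le i\le n\}$ with $\neg x=1-x$, $x\to y=\min(1-x+y,1)$. $\mathrm{PDL}_n$: the smallest set of formulas closed under modus ponens, uniform substitution and necessitation (from $\phi$ infer $[\alpha]\phi$), containing all tautologies of $n+1$-valued Łukasiewicz logic and, for all programs $\alpha,\beta$: $[\alpha](p\to q)\to([\alpha]p\to[\alpha]q)$, $[\alpha](p\oplus p)\leftrightarrow([\alpha]p\oplus[\alpha]p)$, $[\alpha](p\odot p)\leftrightarrow([\alpha]p\odot[\alpha]p)$, $[\alpha\cup\beta]p\leftrightarrow([\alpha]p\wedge[\beta]p)$,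 $[\alpha;\beta]p\leftrightarrow[\alpha][\beta]p$, $[q?]p\leftrightarrow(\neg q^n\vee p)$, $[\alpha^*]p\leftrightarrow(p\wedge[\alpha][\alpha^*]p)$, $[\alpha^*]p\to[\alpha^*][\alpha^*]p$, $(p\wedge[\alpha^*](p\to[\alpha]p)^n)\to[\alpha^*]p$. $\mathcal{F}_n$ is $\mathsf{Form}$ modulo $\phi\equiv\psi$ iff $\phi\leftrightarrow\psi\in\mathrm{PDL}_n$ (elements written as representative formulas). Canonical model: $W^c$ is the set of MV-algebra homomorphisms $u:\mathcal{F}_n\to\mathrm{L}_n$ (maps preserving $\to,\neg,1$); for $\alpha\in\Pi$, $R^c_\alpha=\{(u,v):\forall\phi\in\mathcal{F}_n\ (u([\alpha]\phi)=1\Rightarrow v(\phi)=1)\}$. -}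

module Defs where

open import Data.Nat using (ℕ; zero; suc; _∸_; _+_; _⊓_; _≤_)
open import Relation.Binary.PropositionalEquality using (_≡_)

mutual
  data Form (A : Set) : Set where
    var : ℕ → Form A
    bot : Form A
    neg : Form A → Form A
    imp : Form A → Form A → Form A
    box : Prog A → Form A → Form A

  data Prog (A : Set) : Set where
    atom : A → Prog A
    test : Form A → Prog A
    seq  : Prog A → Prog A → Prog A
    cho  : Prog A → Prog A → Prog A
    star : Prog A → Prog A

module _ {A : Set} where
  top : Form A
  top = neg bot

  dia : Prog A → Form A → Form A
  dia α φ = neg (box α (neg φ))

  _∨f_ _∧f_ _⊕f_ _⊙f_ _↔f_ : Form A → Form A → Form A
  φ ∨f ψ = imp (imp φ ψ) ψ
  φ ∧f ψ = neg (neg φ ∨f neg ψ)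
  φ ⊕f ψ = imp (neg φ) ψ
  φ ⊙f ψ = neg (neg φ ⊕f neg ψ)
  φ ↔f ψ = imp φ ψ ⊙f imp ψ φ

  pow : ℕ → Form A → Form A
  pow zero    ψ = top
  pow (suc zero) ψ = ψ
  pow (suc (suc k)) ψ = pow (suc k) ψ ⊙f ψ

  mutual
    subF : (ℕ → Form A) → Form A → Form A
    subF σ (var p)   = σ p
    subF σ bot       = bot
    subF σ (neg φ)   = neg (subF σ φ)
    subF σ (imp φ ψ) = imp (subF σ φ) (subF σ ψ)
    subF σ (box α φ) = box (subP σ α) (subF σ φ)

    subP : (ℕ → Form A) → Prog A → Prog A
    subP σ (atom a)   = atom a
    subP σ (test φ)   = test (subF σ φ)
    subP σ (seq α β)  = seq (subP σ α) (subP σ β)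
    subP σ (cho α β)  = cho (subP σ α) (subP σ β)
    subP σ (star α)   = star (subP σ α)

-- Ł_n is represented by {0,…,n} ⊆ ℕ (i stands for i/n):
-- ¬x = n ∸ x, x→y = min(n ∸ x + y, n), top element n.
module _ (n : ℕ) where
  Lneg : ℕ → ℕ
  Lneg x = n ∸ x

  Limp : ℕ → ℕ → ℕ
  Limp x y = (n ∸ x + y) ⊓ n

module _ {A : Set} (n : ℕ) where
  evalL : (ℕ → ℕ) → (Prog A → Form A → ℕ) → Form A → ℕ
  evalL V B (var p)   = V p
  evalL V B bot       = 0
  evalL V B (neg φ)   = Lneg n (evalL V B φ)
  evalL V B (imp φ ψ) = Limp n (evalL V B φ) (evalL V B ψ)
  evalL V B (box α φ) = B α φ

  -- tautologies of (n+1)-valued Łukasiewicz logic (instances over the modal language)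
  Taut : Form A → Set
  Taut φ = (V : ℕ → ℕ) (B : Prog A → Form A → ℕ) →
           (∀ p → V p ≤ n) → (∀ α ψ → B α ψ ≤ n) → evalL V B φ ≡ n

  private
    p q : Form A
    p = var 0
    q = var 1

  data PDL : Form A → Set where
    taut   : ∀ {φ} → Taut φ → PDL φ
    mp     : ∀ {φ ψ} → PDL φ → PDL (imp φ ψ) → PDL ψ
    usub   : ∀ {φ} (σ : ℕ → Form A) → PDL φ → PDL (subF σ φ)
    nec    : ∀ {φ} (α : Prog A) → PDL φ → PDL (box α φ)
    ax-K   : ∀ α → PDL (imp (box α (imp p q)) (imp (box α p) (box α q)))
    ax-⊕   : ∀ α → PDL (box α (p ⊕f p) ↔f (box α p ⊕f box α p))
    ax-⊙   : ∀ α → PDL (box α (p ⊙f p) ↔f (box α p ⊙f box α p))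
    ax-∪   : ∀ α β → PDL (box (cho α β) p ↔f (box α p ∧f box β p))
    ax-seq : ∀ α β → PDL (box (seq α β) p ↔f box α (box β p))
    ax-test : PDL (box (test q) p ↔f (neg (pow n q) ∨f p))
    ax-*   : ∀ α → PDL (box (star α) p ↔f (p ∧f box α (box (star α) p)))
    ax-4   : ∀ α → PDL (imp (box (star α) p) (box (star α) (box (star α) p)))
    ax-ind : ∀ α → PDL (imp (p ∧f box (star α) (pow n (imp p (box α p)))) (box (star α) p))

  -- F_n = Form / (φ ≡ ψ iff φ↔ψ ∈ PDL_n). A homomorphism F_n → Ł_n is a map on
  -- formulas, constant on equivalence classes, preserving →, ¬, 1.
  record W : Set where
    field
      val     : Form A → ℕ
      bounded : ∀ φ → val φ ≤ n
      resp    : ∀ φ ψ → PDL (φ ↔f ψ) → val φ ≡ val ψ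
      h-imp   : ∀ φ ψ → val (imp φ ψ) ≡ Limp n (val φ) (val ψ)
      h-neg   : ∀ φ → val (neg φ) ≡ Lneg n (val φ)
      h-top   : val top ≡ n
  open W public

  Rc : Prog A → W → W → Set
  Rc α u v = ∀ φ → val u (box α φ) ≡ n → val v φ ≡ n

module Submission where

-- The engine of the proof is truncated doubling  d(x) = min(2x, 1)  on Ł_n:
-- it is the value of ψ ⊕ ψ, and the ⊕/⊙ axioms say that [α] commutes with
-- the squares ψ ↦ ψ ⊕ ψ and ψ ↦ ψ ⊙ ψ at the level of values.  Iterating d
-- n times sends 0 to 0 and every non-zero value to 1, so n-fold iterated
-- squares are "crisp", which turns graded conditions into Boolean ones:
--   (⇒) if u([α]¬φ) > 0, the n-th iterated ⊕-square θ of ¬φ has u([α]θ) = 1,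
--       so v(θ) = 1 for every successor v; but v(φ) = 1 gives v(θ) = 0.
--       Hence u([α]¬φ) = 0, i.e. u(⟨α⟩φ) = 1.
--   (⇐) if u([α]φ) = 1 but v(φ) < 1, the n-th iterated ⊙-square ψ of φ still
--       has u([α](ψ ⊙ ψ)) = 1 while v(ψ) = 0; since ¬(ψ ⊙ ψ) is literally
--       χ = ¬ψ ⊕ ¬ψ, the formula χ is true at v but u(⟨α⟩χ) = 0.
-- The file develops: substitution instances of the ⊕/⊙ axioms, the
-- arithmetic of iterated doubling, the values of iterated squares under a
-- homomorphism, the two Boolean transfer lemmas, and finally the theorem.

open import Defs
open import Data.Nat using (ℕ; NonZero)
open import Relation.Binary.PropositionalEquality using (_≡_)
open import Function.Bundles using (_⇔_)

open import Data.Nat using (zero; suc; _+_; _∸_; _⊓_; _≤_; z≤n; s≤s; _≟_; _≤?_; ≢-nonZero⁻¹)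
open import Data.Nat.Properties
open import Data.Nat.GeneralisedArithmetic using (fold)
open import Data.Sum using (_⊎_; inj₁; inj₂)
open import Data.Empty using (⊥-elim)
open import Relation.Nullary using (yes; no; ¬_)
open import Relation.Binary.PropositionalEquality using (refl; sym; trans; cong; cong₂; subst; module ≡-Reasoning)
open import Function.Bundles using (mk⇔)

fold-commute : {X Y : Set} (f : X → X) (g : Y → Y) (h : X → Y) →
               (∀ x → h (f x) ≡ g (h x)) → ∀ x k → h (fold x f k) ≡ fold (h x) g k
fold-commute f g h comm x zero    = refl
fold-commute f g h comm x (suc k) = trans (comm (fold x f k)) (cong g (fold-commute f g h comm x k))

module _ {A : Set} where
  -- The axioms are stated for the variable p = var 0.  To instantiate p by ψ
  -- inside an arbitrary program α, first shift the variables of α up by one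
  -- so that the substitution "var 0 ↦ ψ, var (k+1) ↦ var k" leaves it intact.
  mutual
    shiftF : Form A → Form A
    shiftF (var k)   = var (suc k)
    shiftF bot       = bot
    shiftF (neg φ)   = neg (shiftF φ)
    shiftF (imp φ ψ) = imp (shiftF φ) (shiftF ψ)
    shiftF (box α φ) = box (shiftP α) (shiftF φ)

    shiftP : Prog A → Prog A
    shiftP (atom a)  = atom a
    shiftP (test φ)  = test (shiftF φ)
    shiftP (seq α β) = seq (shiftP α) (shiftP β)
    shiftP (cho α β) = cho (shiftP α) (shiftP β)
    shiftP (star α)  = star (shiftP α)

  plug : Form A → ℕ → Form A
  plug ψ zero    = ψ
  plug ψ (suc k) = var k

  mutual
    plug-shiftF : ∀ ψ φ → subF (plug ψ) (shiftF φ) ≡ φ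
    plug-shiftF ψ (var k)   = refl
    plug-shiftF ψ bot       = refl
    plug-shiftF ψ (neg φ)   = cong neg (plug-shiftF ψ φ)
    plug-shiftF ψ (imp φ χ) = cong₂ imp (plug-shiftF ψ φ) (plug-shiftF ψ χ)
    plug-shiftF ψ (box α φ) = cong₂ box (plug-shiftP ψ α) (plug-shiftF ψ φ)

    plug-shiftP : ∀ ψ α → subP (plug ψ) (shiftP α) ≡ α
    plug-shiftP ψ (atom a)  = refl
    plug-shiftP ψ (test φ)  = cong test (plug-shiftF ψ φ)
    plug-shiftP ψ (seq α β) = cong₂ seq (plug-shiftP ψ α) (plug-shiftP ψ β)
    plug-shiftP ψ (cho α β) = cong₂ cho (plug-shiftP ψ α) (plug-shiftP ψ β)
    plug-shiftP ψ (star α)  = cong star (plug-shiftP ψ α)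

  -- the ⊕-square and ⊙-square of a formula (iterated with fold below);
  -- note that ¬(ψ ⊙ ψ) is literally ¬ψ ⊕ ¬ψ
  ⊕² ⊙² : Form A → Form A
  ⊕² ψ = ψ ⊕f ψ
  ⊙² ψ = ψ ⊙f ψ

  module _ (n : ℕ) where
    box-⊕² : ∀ α ψ → PDL n (box α (⊕² ψ) ↔f ⊕² (box α ψ))
    box-⊕² α ψ = subst (λ β → PDL n (box β (⊕² ψ) ↔f ⊕² (box β ψ)))
                       (plug-shiftP ψ α) (usub (plug ψ) (ax-⊕ (shiftP α)))

    box-⊙² : ∀ α ψ → PDL n (box α (⊙² ψ) ↔f ⊙² (box α ψ))
    box-⊙² α ψ = subst (λ β → PDL n (box β (⊙² ψ) ↔f ⊙² (box β ψ)))
                       (plug-shiftP ψ α) (usub (plug ψ) (ax-⊙ (shiftP α)))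

module Doubling (n : ℕ) where
  double : ℕ → ℕ
  double x = (x + x) ⊓ n

  double-top : double n ≡ n
  double-top = m≥n⇒m⊓n≡n (m≤m+n n n)

  double-bounded : ∀ x → double x ≤ n
  double-bounded x = m⊓n≤n (x + x) n

  iter-bounded : ∀ {x} → x ≤ n → ∀ k → fold x double k ≤ n
  iter-bounded x≤n zero    = x≤n
  iter-bounded {x} x≤n (suc k) = double-bounded (fold x double k)

  iter-zero : ∀ k → fold 0 double k ≡ 0
  iter-zero zero    = refl
  iter-zero (suc k) = cong double (iter-zero k)

  double-step : ∀ {k} z → suc k ≤ z → double z ≡ n ⊎ suc (suc k) ≤ double z
  double-step {k} z k<z with n ≤? z + z
  ... | yes n≤2z = inj₁ (m≥n⇒m⊓n≡n n≤2z)
  ... | no  n≰2z = inj₂ (subst (suc (suc k) ≤_) (sym (m≤n⇒m⊓n≡m (<⇒≤ (≰⇒> n≰2z)))) k+2≤2z)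
    where
    k+2≤2z : suc (suc k) ≤ z + z
    k+2≤2z = subst (_≤ z + z) (+-comm (suc k) 1) (+-mono-≤ k<z (≤-trans (s≤s z≤n) k<z))

  iter-grows : ∀ {x} → 1 ≤ x → ∀ k → fold x double k ≡ n ⊎ suc k ≤ fold x double k
  iter-grows 1≤x zero = inj₂ 1≤x
  iter-grows {x} 1≤x (suc k) with iter-grows 1≤x k
  ... | inj₁ top = inj₁ (trans (cong double top) double-top)
  ... | inj₂ k<z = double-step (fold x double k) k<z

  iter-saturates : ∀ {x} → 1 ≤ x → x ≤ n → fold x double n ≡ n
  iter-saturates 1≤x x≤n with iter-grows 1≤x n
  ... | inj₁ top = top
  ... | inj₂ n<z = ⊥-elim (<⇒≱ n<z (iter-bounded x≤n n))

open Doubling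

module Values {A : Set} (n : ℕ) (u : W {A} n) where
  neg-zero : ∀ χ → val u (neg χ) ≡ 0 → val u χ ≡ n
  neg-zero χ e = begin
    val u χ               ≡⟨ sym (m∸[m∸n]≡n (bounded u χ)) ⟩
    n ∸ (n ∸ val u χ)     ≡⟨ cong (n ∸_) (trans (sym (h-neg u χ)) e) ⟩
    n                     ∎
    where open ≡-Reasoning

  neg-top : ∀ χ → val u χ ≡ n → val u (neg χ) ≡ 0
  neg-top χ e = trans (h-neg u χ) (trans (cong (n ∸_) e) (n∸n≡0 n))

  val-⊕² : ∀ ψ → val u (⊕² ψ) ≡ double n (val u ψ)
  val-⊕² ψ = begin
    val u (imp (neg ψ) ψ)                ≡⟨ h-imp u (neg ψ) ψ ⟩
    Limp n (val u (neg ψ)) (val u ψ)     ≡⟨ cong (λ t → Limp n t (val u ψ)) (h-neg u ψ) ⟩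
    (n ∸ (n ∸ val u ψ) + val u ψ) ⊓ n    ≡⟨ cong (λ t → (t + val u ψ) ⊓ n) (m∸[m∸n]≡n (bounded u ψ)) ⟩
    double n (val u ψ)                   ∎
    where open ≡-Reasoning

  val-¬⊙² : ∀ ψ → val u (neg (⊙² ψ)) ≡ double n (val u (neg ψ))
  val-¬⊙² ψ = trans (h-neg u (⊙² ψ)) (trans (cong (n ∸_) (h-neg u χ))
                (trans (m∸[m∸n]≡n (bounded u χ)) (val-⊕² (neg ψ))))
    where χ = ⊕² (neg ψ)

  val-box-⊕² : ∀ α ψ → val u (box α (⊕² ψ)) ≡ double n (val u (box α ψ))
  val-box-⊕² α ψ = trans (resp u _ _ (box-⊕² n α ψ)) (val-⊕² (box α ψ))

  val-¬box-⊙² : ∀ α ψ → val u (neg (box α (⊙² ψ))) ≡ double n (val u (neg (box α ψ)))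
  val-¬box-⊙² α ψ = begin
    val u (neg (box α (⊙² ψ)))    ≡⟨ h-neg u _ ⟩
    n ∸ val u (box α (⊙² ψ))      ≡⟨ cong (n ∸_) (resp u _ _ (box-⊙² n α ψ)) ⟩
    n ∸ val u (⊙² (box α ψ))      ≡⟨ sym (h-neg u _) ⟩
    val u (neg (⊙² (box α ψ)))    ≡⟨ val-¬⊙² (box α ψ) ⟩
    double n (val u (neg (box α ψ))) ∎
    where open ≡-Reasoning

  val-⊕²-iter : ∀ ψ k → val u (fold ψ ⊕² k) ≡ fold (val u ψ) (double n) k
  val-⊕²-iter = fold-commute ⊕² (double n) (val u) val-⊕²

  val-box-⊕²-iter : ∀ α ψ k → val u (box α (fold ψ ⊕² k)) ≡ fold (val u (box α ψ)) (double n) k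
  val-box-⊕²-iter α = fold-commute ⊕² (double n) (λ χ → val u (box α χ)) (val-box-⊕² α)

  val-¬⊙²-iter : ∀ ψ k → val u (neg (fold ψ ⊙² k)) ≡ fold (val u (neg ψ)) (double n) k
  val-¬⊙²-iter = fold-commute ⊙² (double n) (λ χ → val u (neg χ)) val-¬⊙²

  val-¬box-⊙²-iter : ∀ α ψ k → val u (neg (box α (fold ψ ⊙² k))) ≡ fold (val u (neg (box α ψ))) (double n) k
  val-¬box-⊙²-iter α = fold-commute ⊙² (double n) (λ χ → val u (neg (box α χ))) (val-¬box-⊙² α)

open Values

module _ {A : Set} (n : ℕ) .{{_ : NonZero n}} where
  -- (⇒) core: along R^c_α, a formula false at the successor is necessarily
  -- false at u.  Otherwise its n-th iterated ⊕-square would be necessary at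
  -- u but false at v.
  successor-zero : ∀ α (u v : W {A} n) → Rc n α u v →
                   ∀ ψ → val v ψ ≡ 0 → val u (box α ψ) ≡ 0
  successor-zero α u v R ψ vψ with val u (box α ψ) ≟ 0
  ... | yes e = e
  ... | no y≢0 = ⊥-elim (≢-nonZero⁻¹ n (trans (sym (R (fold ψ ⊕² n) u-saturated)) v-collapsed))
    where
    u-saturated : val u (box α (fold ψ ⊕² n)) ≡ n
    u-saturated = trans (val-box-⊕²-iter n u α ψ n)
                    (iter-saturates n (n≢0⇒n>0 y≢0) (bounded u (box α ψ)))
    v-collapsed : val v (fold ψ ⊕² n) ≡ 0
    v-collapsed = trans (val-⊕²-iter n v ψ n) (trans (cong (λ t → fold t (double n) n) vψ) (iter-zero n n))

module _ {A : Set} (n : ℕ) where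
  -- (⇐) core: for the n-th iterated ⊙-square ψ of φ, the formula
  -- χ = ¬ψ ⊕ ¬ψ is true wherever φ is not, while ¬χ = ψ ⊙ ψ (the (n+1)-th
  -- iterated ⊙-square) is necessary wherever φ is.
  separator : Form A → Form A
  separator φ = ⊕² (neg (fold φ ⊙² n))

  separator-true : ∀ (v : W {A} n) φ → ¬ val v φ ≡ n → val v (separator φ) ≡ n
  separator-true v φ vφ≢n = begin
    val v (separator φ)               ≡⟨ val-⊕² n v _ ⟩
    double n (val v (neg (fold φ ⊙² n))) ≡⟨ cong (double n) (val-¬⊙²-iter n v φ n) ⟩
    double n (fold (val v (neg φ)) (double n) n)
      ≡⟨ cong (double n) (iter-saturates n 1≤¬φ (bounded v (neg φ))) ⟩
    double n n                        ≡⟨ double-top n ⟩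
    n                                 ∎
    where
    open ≡-Reasoning
    1≤¬φ : 1 ≤ val v (neg φ)
    1≤¬φ = subst (1 ≤_) (sym (h-neg v φ)) (m<n⇒0<n∸m (≤∧≢⇒< (bounded v φ) vφ≢n))

  box-neg-separator : ∀ α (u : W {A} n) φ → val u (box α φ) ≡ n →
                      val u (box α (neg (separator φ))) ≡ n
  box-neg-separator α u φ uφ = neg-zero n u _ (begin
    val u (neg (box α (fold φ ⊙² (suc n))))   ≡⟨ val-¬box-⊙²-iter n u α φ (suc n) ⟩
    fold (val u (neg (box α φ))) (double n) (suc n)
      ≡⟨ cong (λ t → fold t (double n) (suc n)) (neg-top n u _ uφ) ⟩
    fold 0 (double n) (suc n)                  ≡⟨ iter-zero n (suc n) ⟩
    0                                          ∎)
    where open ≡-Reasoning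

lemma5p10 : {A : Set} → A → (n : ℕ) → .{{_ : NonZero n}} →
            (α : Prog A) (u v : W {A} n) →
            Rc n α u v ⇔ (∀ φ → val v φ ≡ n → val u (dia α φ) ≡ n)
lemma5p10 _ n α u v = mk⇔ to from
  where
  to : Rc n α u v → ∀ φ → val v φ ≡ n → val u (dia α φ) ≡ n
  to R φ vφ = trans (h-neg u _)
    (cong (n ∸_) (successor-zero n α u v R (neg φ) (neg-top n v φ vφ)))

  from : (∀ φ → val v φ ≡ n → val u (dia α φ) ≡ n) → Rc n α u v
  from H φ uφ with val v φ ≟ n
  ... | yes vφ = vφ
  ... | no vφ≢n = ⊥-elim (≢-nonZero⁻¹ n (trans (sym (H χ (separator-true n v φ vφ≢n)))
                                               (neg-top n u _ (box-neg-separator n α u φ uφ))))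
    where χ = separator n φ
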